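{- Let $J$ be a jellyfish graph with head $H$ and legs isomorphic to the rooted tree $L$, and let $d^*=D(H)$. Then $D(J)=\min\{c : D(L,c)\ge d^*\}$.
   Context: A labeling $\phi:V(G)\to\{1,\dots,c\}$ of a graph $G$ is distinguishing if the only automorphism $\pi$ of $G$ with $\phi(\pi(v))=\phi(v)$ for all $v$ is the identity; for a rooted tree, automorphisms are required to fix the root. $D(G)$ is the fewest colors in a distinguishing labeling. Two distinguishing labelings $\phi,\phi'$ are equivalent if there is an automorphism $\pi$ with $\phi(v)=\phi'(\pi(v))$ for all $v$; $D(G,c)$ is the number of pairwise inequivalent distinguishing labelings of $G$ using at most $c$ colors (from a fixed set of $c$ colors). A jellyfish graph $J$ is described by a graph $H$ (the head), which contains a Hamiltonian cycle, and a rooted tree $L$: for each vertex $v\in V(H)$ there is a leg $L_v$, a rooted tree with root $v$ isomorphic (as a rooted tree) to $L$; distinct legs are vertex-disjoint, $V(J)$ is the union of the legs, and $E(J)$ consists of the edges of $H$ together with the edges of all legs. -}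

module Defs where

open import Level using (0ℓ)
open import Data.Nat using (ℕ; zero; suc; _*_; _<_; _≤_)
open import Data.Fin using (Fin; zero; suc; inject₁; fromℕ)
open import Data.Fin.Properties using (*↔×)
open import Data.Product using (Σ; ∃; ∃-syntax; _×_; _,_; proj₁; proj₂)
open import Data.Product.Function.NonDependent.Propositional using (_×-↔_)
open import Data.Sum using (_⊎_; inj₁; inj₂)
open import Data.Empty using (⊥)
open import Relation.Nullary using (¬_)
open import Relation.Binary.PropositionalEquality using (_≡_; refl; sym)
open import Function.Bundles using (_↔_; Inverse; _⇔_)
open import Function.Properties.Inverse using (↔-trans)
open import Function.Definitions using (Injective)

record Graph : Set₁ where
  field
    V      : Set
    size   : ℕ
    enum   : Fin size ↔ V
    E      : V → V → Set
    E-sym  : ∀ {u v} → E u v → E v u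
    E-irr  : ∀ {v} → ¬ E v v
open Graph public

Walk : (G : Graph) → V G → V G → Set
Walk G u v = ∃[ k ] Σ (Fin (suc k) → V G) λ f →
  (f zero ≡ u) × (f (fromℕ k) ≡ v) × (∀ (i : Fin k) → E G (f (inject₁ i)) (f (suc i)))

Connected : Graph → Set
Connected G = ∀ u v → Walk G u v

-- A cycle: distinct vertices f 0, …, f k (k+1 ≥ 3 of them), consecutive
-- ones adjacent and f k adjacent to f 0.
IsCycle : (G : Graph) (k : ℕ) → (Fin (suc k) → V G) → Set
IsCycle G k f = (2 ≤ k) × Injective _≡_ _≡_ f
  × (∀ (i : Fin k) → E G (f (inject₁ i)) (f (suc i)))
  × E G (f (fromℕ k)) (f zero)

Acyclic : Graph → Set
Acyclic G = ¬ (∃[ k ] Σ (Fin (suc k) → V G) λ f → IsCycle G k f)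

HasHamiltonianCycle : Graph → Set
HasHamiltonianCycle G = ∃[ k ] Σ (Fin (suc k) → V G) λ f →
  IsCycle G k f × (∀ v → ∃[ i ] f i ≡ v)

record RootedTree : Set₁ where
  field
    graph     : Graph
    root      : V graph
    connected : Connected graph
    acyclic   : Acyclic graph
open RootedTree public

IsGraphAut : (G : Graph) → (V G ↔ V G) → Set
IsGraphAut G π = ∀ u v → E G u v ⇔ E G (Inverse.to π u) (Inverse.to π v)

IsRootedAut : (T : RootedTree) → (V (graph T) ↔ V (graph T)) → Set
IsRootedAut T π = IsGraphAut (graph T) π × (Inverse.to π (root T) ≡ root T)

module _ {V : Set} (IsAut : (V ↔ V) → Set) where

  -- φ : V → Fin c is a labeling with (at most) c colours.
  Distinguishing : {c : ℕ} → (V → Fin c) → Set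
  Distinguishing φ = ∀ (π : V ↔ V) → IsAut π →
    (∀ v → φ (Inverse.to π v) ≡ φ v) → ∀ v → Inverse.to π v ≡ v

  Equivalent : {c : ℕ} → (V → Fin c) → (V → Fin c) → Set
  Equivalent φ ψ = ∃[ π ] IsAut π × (∀ v → φ v ≡ ψ (Inverse.to π v))

  IsDistNumber : ℕ → Set
  IsDistNumber d = (∃[ φ ] Distinguishing {d} φ)
    × (∀ c → c < d → ¬ (∃[ φ ] Distinguishing {c} φ))

  DistCountAtLeast : ℕ → ℕ → Set
  DistCountAtLeast c m = Σ (Fin m → V → Fin c) λ Φ →
    (∀ i → Distinguishing (Φ i)) × (∀ i j → Equivalent (Φ i) (Φ j) → i ≡ j)

D≡ : Graph → ℕ → Set
D≡ G = IsDistNumber (IsGraphAut G)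

D[_,_]≥_ : RootedTree → ℕ → ℕ → Set
D[ L , c ]≥ m = DistCountAtLeast (IsRootedAut L) c m

IsLeast : (ℕ → Set) → ℕ → Set
IsLeast P c = P c × (∀ c' → c' < c → ¬ P c')

-- The jellyfish graph with head H and legs copies of L.
-- Vertex (h , a): vertex a of the leg L_h; (h , root) is identified
-- with the head vertex h.

JE : (H : Graph) (L : RootedTree) → (V H × V (graph L)) → (V H × V (graph L)) → Set
JE H L (h , a) (h' , a') =
  (a ≡ root L × a' ≡ root L × E H h h') ⊎ (h ≡ h' × E (graph L) a a')

Jellyfish : Graph → RootedTree → Graph
Jellyfish H L = record
  { V = V H × V (graph L)
  ; size = size H * size (graph L)
  ; enum = ↔-trans *↔× (enum H ×-↔ enum (graph L))
  ; E = JE H L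
  ; E-sym = λ { (inj₁ (p , q , e)) → inj₁ (q , p , E-sym H e)
              ; (inj₂ (refl , e)) → inj₂ (refl , E-sym (graph L) e) }
  ; E-irr = λ { (inj₁ (_ , _ , e)) → E-irr H e
              ; (inj₂ (_ , e)) → E-irr (graph L) e }
  }

-- Every root of J lies on a cycle (the Hamiltonian cycle of H), whereas a non-root leg vertex lies
-- on none, because a leg meets the rest of J only in its root. So an automorphism of J permutes the
-- roots and maps legs onto legs: it is an automorphism σ of H together with rooted automorphisms τ_h
-- of L, and every such family conversely assembles to an automorphism of J. Hence, given a
-- distinguishing labeling ψ of H with d colours and d inequivalent distinguishing labelings Φ_i of L,
-- labeling leg h by Φ_(ψ h) distinguishes J. Conversely the leg labelings of a distinguishing
-- labeling of J are distinguishing, and h ↦ (class of its leg labeling) distinguishes H, so there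
-- are at least D(H) classes. Choosing class representatives constructively needs equivalence of
-- labelings of L to be decidable: a finite search, once adjacency in a tree is decided by
-- shortening walks to simple routes.

module Submission where

open import Defs
open import Data.Nat using (ℕ; zero; suc; _+_; _<_; _≤_; z≤n; s≤s)
import Data.Nat.Properties as ℕ
open import Data.Fin using (Fin; zero; suc; inject₁; fromℕ; fromℕ<; toℕ; inject≤)
import Data.Fin.Properties as Fin
import Data.Vec.Functional as Vector
open import Data.Product using (Σ; ∃; ∃-syntax; _×_; _,_; proj₁; proj₂)
open import Data.Product.Function.Dependent.Propositional using (Σ-↔)
open import Data.Sum using (inj₁; inj₂)
open import Data.Empty using (⊥-elim)
open import Data.List using (List; []; _∷_; length; lookup)
import Data.List.Relation.Unary.All as All
open import Data.List.Relation.Unary.AllPairs using ([]; _∷_)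
open import Data.List.Relation.Unary.Unique.Propositional using (Unique)
open import Data.List.Relation.Unary.Any using (here; there)
open import Data.List.Membership.Propositional using (_∈_)
open import Data.List.Membership.Propositional.Properties using (∈-lookup)
import Data.List.Membership.DecPropositional as DecMembership
open import Data.List.Relation.Unary.All.Properties using (¬Any⇒All¬)
open import Relation.Nullary using (¬_; Dec; yes; no)
open import Relation.Nullary.Decidable using (map′; _×-dec_; _→-dec_; via-injection)
open import Relation.Binary.Definitions using (Decidable; DecidableEquality; tri<; tri≈; tri>)
open import Relation.Binary.Structures using (IsEquivalence)
open import Relation.Binary.PropositionalEquality
  using (_≡_; _≢_; refl; sym; trans; cong; cong₂; subst; subst₂; module ≡-Reasoning)
open import Function using (_∘_)
open import Function.Bundles using (_↔_; Inverse; Injection; _⇔_; mk⇔; mk↔ₛ′; Equivalence)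
open import Function.Properties.Inverse using (↔-refl; ↔-sym; ↔-trans; ↔⇒↣)
open import Function.Properties.Equivalence using (⇔-isEquivalence)

open import Level using (0ℓ)

open IsEquivalence (⇔-isEquivalence {0ℓ}) using ()
  renaming (refl to ⇔-refl; sym to ⇔-sym; trans to ⇔-trans)

vertex-≟ : (G : Graph) → DecidableEquality (V G)
vertex-≟ G = via-injection (↔⇒↣ (↔-sym (enum G))) Fin._≟_

module _ (G : Graph) where

  aut-refl : IsGraphAut G ↔-refl
  aut-refl u v = ⇔-refl

  aut-sym : ∀ {π} → IsGraphAut G π → IsGraphAut G (↔-sym π)
  aut-sym {π} π-aut u v = ⇔-sym (subst₂ (λ x y → E G (from u) (from v) ⇔ E G x y)
    (strictlyInverseˡ u) (strictlyInverseˡ v) (π-aut (from u) (from v)))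
    where open Inverse π

  aut-trans : ∀ {π ρ} → IsGraphAut G π → IsGraphAut G ρ → IsGraphAut G (↔-trans π ρ)
  aut-trans π-aut ρ-aut u v = ⇔-trans (π-aut u v) (ρ-aut _ _)

  walk-invariant : (Q : V G → Set) → (∀ {x y} → E G x y → Q x → Q y) →
    ∀ {u v} → Walk G u v → Q u → Q v
  walk-invariant Q step (k , f , refl , refl , es) = along k f es
    where
    along : ∀ k (f : Fin (suc k) → V G) → (∀ i → E G (f (inject₁ i)) (f (suc i))) →
      Q (f zero) → Q (f (fromℕ k))
    along zero f es q = q
    along (suc k) f es q = along k (f ∘ suc) (es ∘ suc) (step (es zero) q)

module _ (T : RootedTree) where

  rootedAut-refl : IsRootedAut T ↔-refl
  rootedAut-refl = aut-refl (graph T) , refl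

  rootedAut-sym : ∀ {π} → IsRootedAut T π → IsRootedAut T (↔-sym π)
  rootedAut-sym {π} (π-aut , fix) =
    aut-sym (graph T) {π} π-aut , trans (cong from (sym fix)) (strictlyInverseʳ (root T))
    where open Inverse π

  rootedAut-trans : ∀ {π ρ} → IsRootedAut T π → IsRootedAut T ρ → IsRootedAut T (↔-trans π ρ)
  rootedAut-trans {π} {ρ} (π-aut , π-fix) (ρ-aut , ρ-fix) =
    aut-trans (graph T) {π} {ρ} π-aut ρ-aut , trans (cong (Inverse.to ρ) π-fix) ρ-fix

module _ (T : RootedTree) {c : ℕ} where

  private
    _≈_ : (V (graph T) → Fin c) → (V (graph T) → Fin c) → Set
    _≈_ = Equivalent (IsRootedAut T)

  equivalent-refl : ∀ φ → φ ≈ φ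
  equivalent-refl φ = ↔-refl , rootedAut-refl T , λ _ → refl

  equivalent-sym : ∀ {φ ψ} → φ ≈ ψ → ψ ≈ φ
  equivalent-sym {ψ = ψ} (π , π-aut , φ≡ψπ) = ↔-sym π , rootedAut-sym T {π} π-aut ,
    λ v → sym (trans (φ≡ψπ (from v)) (cong ψ (strictlyInverseˡ v)))
    where open Inverse π

  equivalent-trans : ∀ {φ ψ χ} → φ ≈ ψ → ψ ≈ χ → φ ≈ χ
  equivalent-trans (π , π-aut , φ≡ψπ) (ρ , ρ-aut , ψ≡χρ) =
    ↔-trans π ρ , rootedAut-trans T {π} {ρ} π-aut ρ-aut , λ v → trans (φ≡ψπ v) (ψ≡χρ _)

record Transversal {X A : Set} (_~_ : A → A → Set) (g : X → A) : Set where
  field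
    #classes         : ℕ
    rep              : Fin #classes → X
    rep-inequivalent : ∀ i j → g (rep i) ~ g (rep j) → i ≡ j
    class            : X → Fin #classes
    class-equivalent : ∀ x → g x ~ g (rep (class x))

module _ {A : Set} {_~_ : A → A → Set} (~-refl : ∀ x → x ~ x)
         (~-sym : ∀ {x y} → x ~ y → y ~ x) (_~?_ : Decidable _~_) where

  private
    module _ {n} {g : Fin (suc n) → A} (T : Transversal _~_ (g ∘ suc)) where
      open Transversal T

      existing-class : ∀ i → g zero ~ g (suc (rep i)) → Transversal _~_ g
      existing-class i g₀~ = record
        { #classes = #classes ; rep = suc ∘ rep ; rep-inequivalent = rep-inequivalent
        ; class = λ { zero → i ; (suc x) → class x }
        ; class-equivalent = λ { zero → g₀~ ; (suc x) → class-equivalent x } }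

      new-class : (∀ i → ¬ g zero ~ g (suc (rep i))) → Transversal _~_ g
      new-class fresh = record
        { #classes = suc #classes
        ; rep = λ { zero → zero ; (suc i) → suc (rep i) }
        ; rep-inequivalent = λ
            { zero zero _ → refl
            ; zero (suc j) g₀~ → ⊥-elim (fresh j g₀~)
            ; (suc i) zero ~g₀ → ⊥-elim (fresh i (~-sym ~g₀))
            ; (suc i) (suc j) ~ → cong suc (rep-inequivalent i j ~) }
        ; class = λ { zero → zero ; (suc x) → suc (class x) }
        ; class-equivalent = λ { zero → ~-refl (g zero) ; (suc x) → class-equivalent x } }

    extend : ∀ {n} {g : Fin (suc n) → A} → Transversal _~_ (g ∘ suc) → Transversal _~_ g
    extend {g = g} T with Fin.any? (λ i → g zero ~? g (suc (Transversal.rep T i)))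
    ... | yes (i , g₀~) = existing-class T i g₀~
    ... | no ∄i = new-class T (λ i g₀~ → ∄i (i , g₀~))

  transversal-Fin : ∀ n (g : Fin n → A) → Transversal _~_ g
  transversal-Fin zero g = record
    { #classes = 0 ; rep = λ () ; rep-inequivalent = λ () ; class = λ () ; class-equivalent = λ () }
  transversal-Fin (suc n) g = extend (transversal-Fin n (g ∘ suc))

  transversal : ∀ {X : Set} {n} → Fin n ↔ X → (g : X → A) → Transversal _~_ g
  transversal ι g = record
    { #classes = #classes ; rep = to ∘ rep ; rep-inequivalent = rep-inequivalent
    ; class = class ∘ from
    ; class-equivalent = λ x →
        subst (λ y → g y ~ g (to (rep (class (from x))))) (strictlyInverseˡ x) (class-equivalent (from x)) }
    where
    open Inverse ι
    open Transversal (transversal-Fin _ (g ∘ to))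

any-function? : ∀ n {m} {Q : (Fin n → Fin m) → Set} →
  (∀ {f g} → (∀ i → f i ≡ g i) → Q f → Q g) → (∀ f → Dec (Q f)) → Dec (∃ Q)
any-function? zero resp Q? = map′ (λ q → _ , q) (λ (f , q) → resp (λ ()) q) (Q? (λ ()))
any-function? (suc n) resp Q? =
  map′ (λ (b , f , q) → b Vector.∷ f , q)
       (λ (f , q) → f zero , f ∘ suc , resp (λ { zero → refl ; (suc i) → refl }) q)
       (Fin.any? λ b → any-function? n (λ f≗g → resp λ { zero → refl ; (suc i) → f≗g i })
                                       (λ f → Q? (b Vector.∷ f)))

lookup-injective : ∀ {A : Set} {xs : List A} → Unique xs → ∀ {i j} → lookup xs i ≡ lookup xs j → i ≡ j
lookup-injective (_ ∷ _) {zero} {zero} _ = refl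
lookup-injective (x∉ ∷ _) {zero} {suc j} eq = ⊥-elim (All.lookup x∉ (∈-lookup j) eq)
lookup-injective (x∉ ∷ _) {suc i} {zero} eq = ⊥-elim (All.lookup x∉ (∈-lookup i) (sym eq))
lookup-injective (_ ∷ u) {suc i} {suc j} eq = cong suc (lookup-injective u eq)

module _ {G : Graph} where

  -- Route b a xs: a walk from a to b whose vertices after a are xs.
  data Route (b : V G) : V G → List (V G) → Set where
    done : Route b b []
    step : ∀ {a c xs} → E G a c → Route b c xs → Route b a (c ∷ xs)

  SimpleRoute : V G → V G → Set
  SimpleRoute a b = ∃ λ xs → Route b a xs × Unique (a ∷ xs)

  route-edge : ∀ {a b xs} → Route b a xs → ∀ i →
    E G (lookup (a ∷ xs) (inject₁ i)) (lookup (a ∷ xs) (suc i))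
  route-edge (step e _) zero = e
  route-edge (step _ p) (suc i) = route-edge p i

  route-last : ∀ {a b xs} → Route b a xs → lookup (a ∷ xs) (fromℕ (length xs)) ≡ b
  route-last done = refl
  route-last (step _ p) = route-last p

  shortcut : ∀ {a b c xs} → a ∈ c ∷ xs → Route b c xs → Unique (c ∷ xs) → SimpleRoute a b
  shortcut (here refl) p u = _ , p , u
  shortcut (there a∈) (step _ p) (_ ∷ u) = shortcut a∈ p u

  walk⇒simpleRoute : ∀ {a b} → Walk G a b → SimpleRoute a b
  walk⇒simpleRoute (k , f , refl , refl , es) = erase-loops k f es
    where
    open DecMembership (vertex-≟ G) using (_∈?_)
    erase-loops : ∀ k (f : Fin (suc k) → V G) → (∀ i → E G (f (inject₁ i)) (f (suc i))) →
      SimpleRoute (f zero) (f (fromℕ k))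
    erase-loops zero f es = [] , done , All.[] ∷ []
    erase-loops (suc k) f es with erase-loops k (f ∘ suc) (es ∘ suc)
    ... | xs , p , u with f zero ∈? f (suc zero) ∷ xs
    ...   | yes f₀∈ = shortcut f₀∈ p u
    ...   | no f₀∉ = _ , step (es zero) p , ¬Any⇒All¬ _ f₀∉ ∷ u

-- A simple route from a to b with two or more edges would close a cycle with an edge b — a.
adjacent? : ∀ {G} → Connected G → Acyclic G → Decidable (E G)
adjacent? {G} conn acyc a b with walk⇒simpleRoute {G} (conn a b)
... | [] , done , _ = no (E-irr G)
... | _ ∷ [] , step e done , _ = yes e
... | c ∷ d ∷ xs , p , u = no λ e → acyc (_ , lookup (a ∷ c ∷ d ∷ xs) ,
  s≤s (s≤s z≤n) , lookup-injective u , route-edge p ,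
  subst (λ z → E G z a) (sym (route-last p)) (E-sym G e))

_⇔-dec_ : ∀ {A B : Set} → Dec A → Dec B → Dec (A ⇔ B)
A? ⇔-dec B? = map′ (λ (f , g) → mk⇔ f g) (λ A⇔B → Equivalence.to A⇔B , Equivalence.from A⇔B)
  ((A? →-dec B?) ×-dec (B? →-dec A?))

module _ (T : RootedTree) {c : ℕ} (φ ψ : V (graph T) → Fin c) where

  private
    G = graph T
    n = size G
    ι = enum G
    open Inverse ι using (to; from; strictlyInverseˡ; strictlyInverseʳ)
    E? = adjacent? {G} (connected T) (acyclic T)

  -- A rooted automorphism carrying φ to ψ, transported along enum so that it can be searched for:
  -- a permutation f of Fin n with inverse g.
  EquivalenceCode : (Fin n → Fin n) → (Fin n → Fin n) → Set
  EquivalenceCode f g = (∀ i → g (f i) ≡ i) × (∀ i → f (g i) ≡ i)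
    × (∀ i j → E G (to i) (to j) ⇔ E G (to (f i)) (to (f j)))
    × (f (from (root T)) ≡ from (root T)) × (∀ i → φ (to i) ≡ ψ (to (f i)))

  equivalenceCode? : ∀ f g → Dec (EquivalenceCode f g)
  equivalenceCode? f g =
    Fin.all? (λ i → g (f i) Fin.≟ i) ×-dec Fin.all? (λ i → f (g i) Fin.≟ i)
    ×-dec Fin.all? (λ i → Fin.all? λ j → E? (to i) (to j) ⇔-dec E? (to (f i)) (to (f j)))
    ×-dec f (from (root T)) Fin.≟ from (root T) ×-dec Fin.all? (λ i → φ (to i) Fin.≟ ψ (to (f i)))

  equivalenceCode-respʳ : ∀ {f g g'} → (∀ i → g i ≡ g' i) → EquivalenceCode f g → EquivalenceCode f g'
  equivalenceCode-respʳ {f} g≗g' (gf , fg , aut , fix , lab) =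
    (λ i → trans (sym (g≗g' (f i))) (gf i)) , (λ i → trans (cong f (sym (g≗g' i))) (fg i)) ,
    aut , fix , lab

  equivalenceCode-respˡ : ∀ {f f'} → (∀ i → f i ≡ f' i) →
    ∃ (EquivalenceCode f) → ∃ (EquivalenceCode f')
  equivalenceCode-respˡ f≗f' (g , gf , fg , aut , fix , lab) = g ,
    (λ i → trans (cong g (sym (f≗f' i))) (gf i)) , (λ i → trans (sym (f≗f' (g i))) (fg i)) ,
    (λ i j → subst₂ (λ x y → E G (to i) (to j) ⇔ E G (to x) (to y)) (f≗f' i) (f≗f' j) (aut i j)) ,
    trans (sym (f≗f' _)) fix , (λ i → trans (lab i) (cong (ψ ∘ to) (f≗f' i)))

  equivalent⇒code : Equivalent (IsRootedAut T) φ ψ → ∃ λ f → ∃ (EquivalenceCode f)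
  equivalent⇒code (π , (π-aut , π-fix) , lab) = f , g ,
    (λ i → trans (cong (from ∘ π⁻¹) (strictlyInverseˡ _))
                 (trans (cong from (Inverse.strictlyInverseʳ π _)) (strictlyInverseʳ i))) ,
    (λ i → trans (cong (from ∘ π⁺) (strictlyInverseˡ _))
                 (trans (cong from (Inverse.strictlyInverseˡ π _)) (strictlyInverseʳ i))) ,
    (λ i j → subst₂ (λ x y → E G (to i) (to j) ⇔ E G x y)
                    (sym (strictlyInverseˡ _)) (sym (strictlyInverseˡ _)) (π-aut (to i) (to j))) ,
    trans (cong (from ∘ π⁺) (strictlyInverseˡ (root T))) (cong from π-fix) ,
    (λ i → trans (lab (to i)) (cong ψ (sym (strictlyInverseˡ _))))
    where
    π⁺ = Inverse.to π
    π⁻¹ = Inverse.from π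
    f g : Fin n → Fin n
    f = from ∘ π⁺ ∘ to
    g = from ∘ π⁻¹ ∘ to

  code⇒equivalent : ∀ {f g} → EquivalenceCode f g → Equivalent (IsRootedAut T) φ ψ
  code⇒equivalent {f} {g} (gf , fg , aut , fix , lab) =
    ↔-trans (↔-sym ι) (↔-trans (mk↔ₛ′ f g fg gf) ι) ,
    ((λ u v → subst₂ (λ x y → E G x y ⇔ E G (to (f (from u))) (to (f (from v))))
                     (strictlyInverseˡ u) (strictlyInverseˡ v) (aut (from u) (from v))) ,
     trans (cong to fix) (strictlyInverseˡ (root T))) ,
    (λ v → trans (cong φ (sym (strictlyInverseˡ v))) (lab (from v)))

equivalent? : (T : RootedTree) {c : ℕ} → Decidable (Equivalent (IsRootedAut T) {c})
equivalent? T φ ψ = map′ (λ (_ , _ , code) → code⇒equivalent T φ ψ code) (equivalent⇒code T φ ψ)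
  (any-function? n (equivalenceCode-respˡ T φ ψ)
    (λ f → any-function? n (equivalenceCode-respʳ T φ ψ) (equivalenceCode? T φ ψ f)))
  where n = size (graph T)

-- Positions 0, …, k of a cycle whose closing edge is k — 0: deleting position m leaves a path.
module _ {S : ℕ → Set} {k m : ℕ}
         (step : ∀ {n} → n < k → n ≢ m → suc n ≢ m → S n ⇔ S (suc n))
         (wrap : k ≢ m → 0 ≢ m → S k ⇔ S 0) where

  private
    below : ∀ {j} → j < m → j ≤ k → S 0 ⇔ S j
    below {zero} _ _ = ⇔-refl
    below {suc j} j+1<m j<k =
      ⇔-trans (below j<m (ℕ.<⇒≤ j<k)) (step j<k (ℕ.<⇒≢ j<m) (ℕ.<⇒≢ j+1<m))
      where j<m = ℕ.<-trans (ℕ.n<1+n j) j+1<m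

    above : ∀ d {j} → d + j ≡ k → m < j → S j ⇔ S k
    above zero {j} j≡k _ = subst (λ x → S j ⇔ S x) j≡k ⇔-refl
    above (suc d) {j} d+j+1≡k m<j =
      ⇔-trans (step j<k (ℕ.>⇒≢ m<j) (ℕ.>⇒≢ m<j+1)) (above d (trans (ℕ.+-suc d j) d+j+1≡k) m<j+1)
      where
      m<j+1 = ℕ.m<n⇒m<1+n m<j
      j<k = subst (suc j ≤_) d+j+1≡k (s≤s (ℕ.m≤n+m j d))

    to-top : ∀ {j} → m < j → j ≤ k → S j ⇔ S k
    to-top m<j j≤k = above _ (ℕ.m∸n+n≡m j≤k) m<j

    across : ∀ {i j} → i < m → m < j → j ≤ k → S i ⇔ S j
    across i<m m<j j≤k =
      ⇔-trans (⇔-sym (below i<m (ℕ.<⇒≤ (ℕ.<-≤-trans i<m (ℕ.<⇒≤ m<k)))))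
        (⇔-trans (⇔-sym (wrap (ℕ.>⇒≢ m<k) (ℕ.<⇒≢ (ℕ.≤-<-trans z≤n i<m))))
                 (⇔-sym (to-top m<j j≤k)))
      where m<k = ℕ.<-≤-trans m<j j≤k

  invariant-away-from : ∀ {i j} → i ≤ k → j ≤ k → i ≢ m → j ≢ m → S i ⇔ S j
  invariant-away-from {i} {j} i≤k j≤k i≢m j≢m with ℕ.<-cmp i m | ℕ.<-cmp j m
  ... | tri< i<m _ _ | tri< j<m _ _ = ⇔-trans (⇔-sym (below i<m i≤k)) (below j<m j≤k)
  ... | tri> _ _ m<i | tri> _ _ m<j = ⇔-trans (to-top m<i i≤k) (⇔-sym (to-top m<j j≤k))
  ... | tri< i<m _ _ | tri> _ _ m<j = across i<m m<j j≤k
  ... | tri> _ _ m<i | tri< j<m _ _ = ⇔-sym (across j<m m<i i≤k)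
  ... | tri≈ _ i≡m _ | _ = ⊥-elim (i≢m i≡m)
  ... | _ | tri≈ _ j≡m _ = ⊥-elim (j≢m j≡m)

-- Positions of a cycle read as natural numbers; values beyond k are truncated to k.
clamp : ∀ k → ℕ → Fin (suc k)
clamp k zero = zero
clamp zero (suc n) = zero
clamp (suc k) (suc n) = suc (clamp k n)

clamp-toℕ : ∀ k (i : Fin (suc k)) → clamp k (toℕ i) ≡ i
clamp-toℕ k zero = refl
clamp-toℕ (suc k) (suc i) = cong suc (clamp-toℕ k i)

toℕ-clamp : ∀ {k n} → n ≤ k → toℕ (clamp k n) ≡ n
toℕ-clamp {n = zero} _ = refl
toℕ-clamp (s≤s n≤k) = cong suc (toℕ-clamp n≤k)

clamp-inject₁ : ∀ {k n} (n<k : n < k) → clamp k n ≡ inject₁ (fromℕ< n<k)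
clamp-inject₁ {n = zero} (s≤s _) = refl
clamp-inject₁ {n = suc n} (s≤s n<k) = cong suc (clamp-inject₁ n<k)

clamp-suc : ∀ {k n} (n<k : n < k) → clamp k (suc n) ≡ suc (fromℕ< n<k)
clamp-suc {n = zero} (s≤s _) = refl
clamp-suc {n = suc n} (s≤s n<k) = cong suc (clamp-suc n<k)

clamp-fromℕ : ∀ k → clamp k k ≡ fromℕ k
clamp-fromℕ zero = refl
clamp-fromℕ (suc k) = cong suc (clamp-fromℕ k)

module _ (G : Graph) {k} {f : Fin (suc k) → V G} (cyc : IsCycle G k f) where

  cycle-edge : ∀ {n} → n < k → E G (f (clamp k n)) (f (clamp k (suc n)))
  cycle-edge n<k = subst₂ (E G) (cong f (sym (clamp-inject₁ n<k))) (cong f (sym (clamp-suc n<k)))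
    (proj₁ (proj₂ (proj₂ cyc)) (fromℕ< n<k))

  cycle-close : E G (f (clamp k k)) (f (clamp k 0))
  cycle-close = subst (λ x → E G (f x) (f zero)) (sym (clamp-fromℕ k)) (proj₂ (proj₂ (proj₂ cyc)))

OnCycle : (G : Graph) → V G → Set
OnCycle G x = ∃[ k ] Σ (Fin (suc k) → V G) λ f → IsCycle G k f × ∃[ i ] f i ≡ x

aut-onCycle : ∀ G {π} → IsGraphAut G π → ∀ {x} → OnCycle G x → OnCycle G (Inverse.to π x)
aut-onCycle G {π} π-aut (k , f , (k≥2 , inj , edges , close) , i , refl) =
  k , Inverse.to π ∘ f ,
  (k≥2 , inj ∘ Injection.injective (↔⇒↣ π) ,
   (λ j → Equivalence.to (π-aut _ _) (edges j)) , Equivalence.to (π-aut _ _) close) ,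
  i , refl

module _ (H : Graph) (L : RootedTree) where

  private
    J = Jellyfish H L
    T = graph L
    r = root L

  head-edge : ∀ {h h'} → JE H L (h , r) (h' , r) ⇔ E H h h'
  head-edge = mk⇔ (λ { (inj₁ (_ , _ , e)) → e ; (inj₂ (_ , e)) → ⊥-elim (E-irr T e) })
                  (λ e → inj₁ (refl , refl , e))

  leg-edge : ∀ {h a b} → JE H L (h , a) (h , b) ⇔ E T a b
  leg-edge = mk⇔ (λ { (inj₁ (_ , _ , e)) → ⊥-elim (E-irr H e) ; (inj₂ (_ , e)) → e })
                 (λ e → inj₂ (refl , e))

  head-onCycle : HasHamiltonianCycle H → ∀ h → OnCycle J (h , r)
  head-onCycle (k , f , (k≥2 , inj , edges , close) , onto) h =
    k , (λ i → f i , r) ,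
    (k≥2 , inj ∘ cong proj₁ , (λ i → inj₁ (refl , refl , edges i)) , inj₁ (refl , refl , close)) ,
    proj₁ (onto h) , cong (_, r) (proj₂ (onto h))

  leg-cycle : ∀ {k g h} → IsCycle J k g → (∀ x → proj₁ (g x) ≡ h) → IsCycle T k (proj₂ ∘ g)
  leg-cycle {k} {g} (k≥2 , inj , edges , close) in-leg =
    k≥2 , inj ∘ same-leg ,
    (λ j → project (inject₁≢suc j) (edges j)) , project (fromℕ≢zero k≥2) close
    where
    same-leg : ∀ {x y} → proj₂ (g x) ≡ proj₂ (g y) → g x ≡ g y
    same-leg {x} {y} eq = cong₂ _,_ (trans (in-leg x) (sym (in-leg y))) eq
    project : ∀ {x y} → x ≢ y → JE H L (g x) (g y) → E T (proj₂ (g x)) (proj₂ (g y))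
    project x≢y (inj₁ (p , q , _)) = ⊥-elim (x≢y (inj (same-leg (trans p (sym q)))))
    project _ (inj₂ (_ , e)) = e
    inject₁≢suc : ∀ {k} (j : Fin k) → inject₁ j ≢ suc j
    inject₁≢suc j eq = ℕ.1+n≢n (sym (trans (sym (Fin.toℕ-inject₁ j)) (cong toℕ eq)))
    fromℕ≢zero : ∀ {k} → 2 ≤ k → fromℕ k ≢ zero
    fromℕ≢zero (s≤s _) ()

  -- Only (h , r) links leg h to the rest of J, and a cycle meets it at most once, at position m
  -- (m = suc k when it does not meet it); removing it leaves a path that cannot leave the leg.
  private
    module WithinLeg {k} {g : Fin (suc k) → V J} (cyc : IsCycle J k g) {h a i}
                     (gi≡ : g i ≡ (h , a)) (a≢r : a ≢ r) (m : ℕ)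
                     (only-at-m : ∀ {n} → n ≤ k → g (clamp k n) ≡ (h , r) → n ≡ m)
                     (at-m : m ≤ k → g (clamp k m) ≡ (h , r)) where

      InLeg : V J → Set
      InLeg x = proj₁ x ≡ h

      edge-⇔ : ∀ {x y} → JE H L x y → x ≢ (h , r) → y ≢ (h , r) → InLeg x ⇔ InLeg y
      edge-⇔ (inj₁ (refl , refl , _)) x≢ y≢ =
        mk⇔ (λ x∈ → ⊥-elim (x≢ (cong (_, r) x∈))) (λ y∈ → ⊥-elim (y≢ (cong (_, r) y∈)))
      edge-⇔ (inj₂ (refl , _)) _ _ = ⇔-refl

      away : ∀ {n} → n ≤ k → n ≢ m → g (clamp k n) ≢ (h , r)
      away n≤k n≢m = n≢m ∘ only-at-m n≤k

      invariant : ∀ {i j} → i ≤ k → j ≤ k → i ≢ m → j ≢ m →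
        InLeg (g (clamp k i)) ⇔ InLeg (g (clamp k j))
      invariant = invariant-away-from
        (λ n<k n≢m n+1≢m → edge-⇔ (cycle-edge J cyc n<k) (away (ℕ.<⇒≤ n<k) n≢m) (away n<k n+1≢m))
        (λ k≢m 0≢m → edge-⇔ (cycle-close J cyc) (away ℕ.≤-refl k≢m) (away z≤n 0≢m))

      at-i : g (clamp k (toℕ i)) ≡ (h , a)
      at-i = trans (cong g (clamp-toℕ k i)) gi≡

      at : ∀ {n} → n ≤ k → n ≡ m → g (clamp k n) ≡ (h , r)
      at n≤k refl = at-m n≤k

      i≢m : toℕ i ≢ m
      i≢m i≡m = a≢r (cong proj₂ (trans (sym at-i) (at (Fin.toℕ≤pred[n] i) i≡m)))

      within-at : ∀ {j} → j ≤ k → InLeg (g (clamp k j))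
      within-at {j} j≤k with j ℕ.≟ m
      ... | yes j≡m = cong proj₁ (at j≤k j≡m)
      ... | no j≢m = Equivalence.to (invariant (Fin.toℕ≤pred[n] i) j≤k i≢m j≢m) (cong proj₁ at-i)

      within : ∀ x → InLeg (g x)
      within x = subst (InLeg ∘ g) (clamp-toℕ k x) (within-at (Fin.toℕ≤pred[n] x))

  cycle-within-leg : ∀ {k g h a i} → IsCycle J k g → g i ≡ (h , a) → a ≢ r →
    ∀ x → proj₁ (g x) ≡ h
  cycle-within-leg {k} {g} {h} cyc gi≡ a≢r with Fin.any? (λ j → vertex-≟ J (g j) (h , r))
  ... | yes (j , gj≡) = WithinLeg.within cyc gi≡ a≢r (toℕ j)
          (λ n≤k gn≡ → trans (sym (toℕ-clamp n≤k))
                              (cong toℕ (proj₁ (proj₂ cyc) (trans gn≡ (sym gj≡)))))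
          (λ _ → trans (cong g (clamp-toℕ k j)) gj≡)
  ... | no ∄j = WithinLeg.within cyc gi≡ a≢r (suc k)
          (λ {n} _ gn≡ → ⊥-elim (∄j (clamp k n , gn≡)))
          (λ k+1≤k → ⊥-elim (ℕ.1+n≰n k+1≤k))

  nonroot-not-onCycle : ∀ {h a} → a ≢ r → ¬ OnCycle J (h , a)
  nonroot-not-onCycle a≢r (k , g , cyc , i , gi≡) =
    acyclic L (k , proj₂ ∘ g , leg-cycle cyc (cycle-within-leg cyc gi≡ a≢r))

  assemble : (V H ↔ V H) → (V H → V T ↔ V T) → V J ↔ V J
  assemble σ τ = Σ-↔ σ (λ {h} → τ h)

  assemble-aut : ∀ {σ τ} → IsGraphAut H σ → (∀ h → IsRootedAut L (τ h)) → IsGraphAut J (assemble σ τ)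
  assemble-aut {σ} {τ} σ-aut τ-aut (h , a) (h' , a') = mk⇔ forth back
    where
    τ⁺ : V H → V T → V T
    τ⁺ h = Inverse.to (τ h)
    reflects-root : ∀ h {a} → τ⁺ h a ≡ r → a ≡ r
    reflects-root h τa≡r = Injection.injective (↔⇒↣ (τ h)) (trans τa≡r (sym (proj₂ (τ-aut h))))
    same-head : ∀ {h h' a a'} → h ≡ h' → E T (τ⁺ h a) (τ⁺ h' a') → JE H L (h , a) (h' , a')
    same-head {h} {a = a} {a'} refl e = inj₂ (refl , Equivalence.from (proj₁ (τ-aut h) a a') e)
    forth : JE H L (h , a) (h' , a') → JE H L (Inverse.to σ h , τ⁺ h a) (Inverse.to σ h' , τ⁺ h' a')
    forth (inj₁ (refl , refl , e)) =
      inj₁ (proj₂ (τ-aut h) , proj₂ (τ-aut h') , Equivalence.to (σ-aut h h') e)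
    forth (inj₂ (refl , e)) = inj₂ (refl , Equivalence.to (proj₁ (τ-aut h) a a') e)
    back : JE H L (Inverse.to σ h , τ⁺ h a) (Inverse.to σ h' , τ⁺ h' a') → JE H L (h , a) (h' , a')
    back (inj₁ (p , q , e)) = inj₁ (reflects-root h p , reflects-root h' q , Equivalence.from (σ-aut h h') e)
    back (inj₂ (p , e)) = same-head (Injection.injective (↔⇒↣ σ) p) e

  aut-fixes-roots : HasHamiltonianCycle H → ∀ {π} → IsGraphAut J π →
    ∀ h → proj₂ (Inverse.to π (h , r)) ≡ r
  aut-fixes-roots ham {π} π-aut h with vertex-≟ T (proj₂ (Inverse.to π (h , r))) r
  ... | yes ≡r = ≡r
  ... | no ≢r = ⊥-elim (nonroot-not-onCycle ≢r (aut-onCycle J {π} π-aut (head-onCycle ham h)))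

  module AutJellyfish (ham : HasHamiltonianCycle H) {π : V J ↔ V J} (π-aut : IsGraphAut J π) where

    private
      π⁺ = Inverse.to π
      π⁻ = Inverse.from π

    reflects-roots : ∀ {h a} → proj₂ (π⁺ (h , a)) ≡ r → a ≡ r
    reflects-roots {h} {a} ↦r = begin
      a                       ≡⟨ cong proj₂ (sym (Inverse.strictlyInverseʳ π (h , a))) ⟩
      proj₂ (π⁻ (π⁺ (h , a))) ≡⟨ cong (λ b → proj₂ (π⁻ (h′ , b))) ↦r ⟩
      proj₂ (π⁻ (h′ , r))     ≡⟨ aut-fixes-roots ham {↔-sym π} (aut-sym J {π} π-aut) h′ ⟩
      r                       ∎
      where
      open ≡-Reasoning
      h′ = proj₁ (π⁺ (h , a))

    same-leg : ∀ h a → proj₁ (π⁺ (h , a)) ≡ proj₁ (π⁺ (h , r))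
    same-leg h a = walk-invariant T Q along-edge (connected L r a) refl
      where
      Q : V T → Set
      Q b = proj₁ (π⁺ (h , b)) ≡ proj₁ (π⁺ (h , r))
      along-edge : ∀ {u v} → E T u v → Q u → Q v
      along-edge {u} {v} e Qu with Equivalence.to (π-aut (h , u) (h , v)) (inj₂ (refl , e))
      ... | inj₁ (u↦r , v↦r , _) =
            ⊥-elim (E-irr T (subst₂ (E T) (reflects-roots u↦r) (reflects-roots v↦r) e))
      ... | inj₂ (same , _) = trans (sym same) Qu

    to-leg : ∀ h a → π⁺ (h , a) ≡ (proj₁ (π⁺ (h , r)) , proj₂ (π⁺ (h , a)))
    to-leg h a = cong (_, proj₂ (π⁺ (h , a))) (same-leg h a)

    to-root : ∀ h → π⁺ (h , r) ≡ (proj₁ (π⁺ (h , r)) , r)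
    to-root h = cong (proj₁ (π⁺ (h , r)) ,_) (aut-fixes-roots ham {π} π-aut h)

  record Factorisation (π : V J ↔ V J) : Set where
    field
      σ     : V H ↔ V H
      σ-aut : IsGraphAut H σ
      τ     : V H → V T ↔ V T
      τ-aut : ∀ h → IsRootedAut L (τ h)
      to-≡  : ∀ h a → Inverse.to π (h , a) ≡ (Inverse.to σ h , Inverse.to (τ h) a)

  factorise : HasHamiltonianCycle H → ∀ {π} → IsGraphAut J π → Factorisation π
  factorise ham {π} π-aut = record
    { σ = mk↔ₛ′ σ⁺ σ⁻ σ⁺∘σ⁻ σ⁻∘σ⁺
    ; σ-aut = λ h h' → ⇔-trans (⇔-sym head-edge) (⇔-trans
        (subst₂ (λ x y → JE H L (h , r) (h' , r) ⇔ JE H L x y) (to-root h) (to-root h') (π-aut _ _))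
        head-edge)
    ; τ = λ h → mk↔ₛ′ (τ⁺ h) (τ⁻ h) (τ⁺∘τ⁻ h) (τ⁻∘τ⁺ h)
    ; τ-aut = λ h → (λ a b → ⇔-trans (⇔-sym leg-edge) (⇔-trans
        (subst₂ (λ x y → JE H L (h , a) (h , b) ⇔ JE H L x y) (to-leg h a) (to-leg h b) (π-aut _ _))
        leg-edge)) ,
        aut-fixes-roots ham {π} π-aut h
    ; to-≡ = to-leg
    }
    where
    open AutJellyfish ham {π} π-aut
    module Inv = AutJellyfish ham {↔-sym π} (aut-sym J {π} π-aut)
    open Inverse π using (strictlyInverseˡ; strictlyInverseʳ) renaming (to to π⁺; from to π⁻)

    σ⁺ σ⁻ : V H → V H
    σ⁺ h = proj₁ (π⁺ (h , r))
    σ⁻ y = proj₁ (π⁻ (y , r))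

    σ⁺∘σ⁻ : ∀ y → σ⁺ (σ⁻ y) ≡ y
    σ⁺∘σ⁻ y = cong proj₁ (trans (cong π⁺ (sym (Inv.to-root y))) (strictlyInverseˡ (y , r)))

    σ⁻∘σ⁺ : ∀ h → σ⁻ (σ⁺ h) ≡ h
    σ⁻∘σ⁺ h = cong proj₁ (trans (cong π⁻ (sym (to-root h))) (strictlyInverseʳ (h , r)))

    τ⁺ τ⁻ : V H → V T → V T
    τ⁺ h a = proj₂ (π⁺ (h , a))
    τ⁻ h b = proj₂ (π⁻ (σ⁺ h , b))

    τ⁺∘τ⁻ : ∀ h b → τ⁺ h (τ⁻ h b) ≡ b
    τ⁺∘τ⁻ h b = cong proj₂ (trans (cong π⁺ from-leg) (strictlyInverseˡ (σ⁺ h , b)))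
      where
      from-leg : (h , τ⁻ h b) ≡ π⁻ (σ⁺ h , b)
      from-leg = trans (cong (_, τ⁻ h b) (sym (σ⁻∘σ⁺ h))) (sym (Inv.to-leg (σ⁺ h) b))

    τ⁻∘τ⁺ : ∀ h a → τ⁻ h (τ⁺ h a) ≡ a
    τ⁻∘τ⁺ h a = cong proj₂ (trans (cong π⁻ (sym (to-leg h a))) (strictlyInverseʳ (h , a)))

module _ {H : Graph} {L : RootedTree} (ham : HasHamiltonianCycle H) where

  private
    J = Jellyfish H L
    T = graph L
    r = root L

  distinguishing-from-legs : ∀ {d c} → ∃[ ψ ] Distinguishing (IsGraphAut H) {d} ψ → D[ L , c ]≥ d →
    ∃[ φ ] Distinguishing (IsGraphAut J) {c} φ
  distinguishing-from-legs (ψ , ψ-dist) (Φ , Φ-dist , Φ-inequivalent) = φ , φ-dist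
    where
    φ : V J → _
    φ (h , a) = Φ (ψ h) a

    φ-dist : Distinguishing (IsGraphAut J) φ
    φ-dist π π-aut preserves (h , a) = trans (to-≡ h a) (cong₂ _,_ (σ-id h) (τ-id h a))
      where
      open Factorisation (factorise H L ham {π} π-aut)
      preserves-legs : ∀ h a → Φ (ψ (Inverse.to σ h)) (Inverse.to (τ h) a) ≡ Φ (ψ h) a
      preserves-legs h a = trans (cong φ (sym (to-≡ h a))) (preserves (h , a))
      ψ∘σ : ∀ h → ψ (Inverse.to σ h) ≡ ψ h
      ψ∘σ h = sym (Φ-inequivalent (ψ h) (ψ (Inverse.to σ h)) (τ h , τ-aut h , sym ∘ preserves-legs h))
      σ-id : ∀ h → Inverse.to σ h ≡ h
      σ-id = ψ-dist σ σ-aut ψ∘σ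
      τ-id : ∀ h a → Inverse.to (τ h) a ≡ a
      τ-id h = Φ-dist (ψ h) (τ h) (τ-aut h)
        (λ a → trans (cong (λ i → Φ i (Inverse.to (τ h) a)) (sym (ψ∘σ h))) (preserves-legs h a))

  module _ {c : ℕ} {φ : V J → Fin c} (φ-dist : Distinguishing (IsGraphAut J) φ) where

    private
      leg : V H → V T → Fin c
      leg h a = φ (h , a)

    leg-distinguishing : ∀ h → Distinguishing (IsRootedAut L) (leg h)
    leg-distinguishing h τ τ-aut τ-preserves a = on-h (cong proj₂ (φ-dist
      (assemble H L ↔-refl τ-at-h) (assemble-aut H L {↔-refl} {τ-at-h} (aut-refl H) τ-at-h-aut)
      (λ (h' , b) → τ-at-h-preserves h' b) (h , a)))
      where
      τ-at-h : V H → V T ↔ V T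
      τ-at-h h' with vertex-≟ H h' h
      ... | yes _ = τ
      ... | no _ = ↔-refl
      τ-at-h-aut : ∀ h' → IsRootedAut L (τ-at-h h')
      τ-at-h-aut h' with vertex-≟ H h' h
      ... | yes _ = τ-aut
      ... | no _ = rootedAut-refl L
      τ-at-h-preserves : ∀ h' b → leg h' (Inverse.to (τ-at-h h') b) ≡ leg h' b
      τ-at-h-preserves h' b with vertex-≟ H h' h
      ... | yes refl = τ-preserves b
      ... | no _ = refl
      on-h : Inverse.to (τ-at-h h) a ≡ a → Inverse.to τ a ≡ a
      on-h with vertex-≟ H h h
      ... | yes _ = λ fixed → fixed
      ... | no h≢h = ⊥-elim (h≢h refl)

    open Transversal (transversal (equivalent-refl L) (equivalent-sym L) (equivalent? L) (enum H) leg)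

    class-distinguishing : Distinguishing (IsGraphAut H) class
    class-distinguishing σ σ-aut class∘σ h = cong proj₁ (φ-dist
      (assemble H L σ τ) (assemble-aut H L {σ} {τ} σ-aut τ-aut) (λ (h , a) → sym (relabel h a)) (h , r))
      where
      σ⁺ = Inverse.to σ
      σh≈ : ∀ h → Equivalent (IsRootedAut L) (leg (σ⁺ h)) (leg (rep (class h)))
      σh≈ h = subst (λ i → Equivalent (IsRootedAut L) (leg (σ⁺ h)) (leg (rep i))) (class∘σ h)
                    (class-equivalent (σ⁺ h))
      leg≈ : ∀ h → Equivalent (IsRootedAut L) (leg h) (leg (σ⁺ h))
      leg≈ h = equivalent-trans L {φ = leg h} {leg (rep (class h))} {leg (σ⁺ h)} (class-equivalent h)
                 (equivalent-sym L {φ = leg (σ⁺ h)} {leg (rep (class h))} (σh≈ h))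
      τ = λ h → proj₁ (leg≈ h)
      τ-aut = λ h → proj₁ (proj₂ (leg≈ h))
      relabel = λ h → proj₂ (proj₂ (leg≈ h))

    legs-from-distinguishing : ∀ {d} → D≡ H d → D[ L , c ]≥ d
    legs-from-distinguishing {d} (_ , minimal) with d ℕ.≤? #classes
    ... | yes d≤k = (λ i → leg (rep (inject≤ i d≤k))) , (λ i → leg-distinguishing _) ,
                    (λ i j ≈ → Fin.inject≤-injective d≤k d≤k i j (rep-inequivalent _ _ ≈))
    ... | no d≰k = ⊥-elim (minimal #classes (ℕ.≰⇒> d≰k) (class , class-distinguishing))

  distinguishable-⇔-legs : ∀ {d} → D≡ H d → ∀ c →
    (∃[ φ ] Distinguishing (IsGraphAut J) {c} φ) ⇔ D[ L , c ]≥ d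
  distinguishable-⇔-legs D[H]≡d c =
    mk⇔ (λ (_ , φ-dist) → legs-from-distinguishing φ-dist D[H]≡d)
        (distinguishing-from-legs (proj₁ D[H]≡d))

IsLeast-cong : ∀ {P Q : ℕ → Set} → (∀ c → P c ⇔ Q c) → ∀ c → IsLeast P c ⇔ IsLeast Q c
IsLeast-cong P⇔Q c = mk⇔
  (λ (Pc , least) → Equivalence.to (P⇔Q c) Pc , λ c' c'<c → least c' c'<c ∘ Equivalence.from (P⇔Q c'))
  (λ (Qc , least) → Equivalence.from (P⇔Q c) Qc , λ c' c'<c → least c' c'<c ∘ Equivalence.to (P⇔Q c'))

theorem3 : (H : Graph) (L : RootedTree) → HasHamiltonianCycle H →
    (d* : ℕ) → D≡ H d* →
    (c : ℕ) → D≡ (Jellyfish H L) c ⇔ IsLeast (λ c' → D[ L , c' ]≥ d*) c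
theorem3 H L ham d* D[H]≡d* = IsLeast-cong (distinguishable-⇔-legs {H} {L} ham {d*} D[H]≡d*)
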